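{- Let $G$ be a connected graph with no subgraph isomorphic to $Y$, and let $P=v_0v_1\dots v_\ell$ be a longest path in $G$, chosen subject to that to minimize $\deg(v_0)+\deg(v_\ell)$, with $\ell\ge5$. Let $L_i=N_G(v_i)\setminus V(P)$. Assume $G$ has no edge $v_av_b$ with $a\in\{0,1\}$, $b\in\{\ell-1,\ell\}$, and $L_1\cap L_{\ell-1}=\emptyset$. If an edge $v_iv_{i+2}$ of $G$ crosses an edge $v_0v_3$ or $v_{\ell-3}v_\ell$ of $G$, then $\ell=5$ and $G$ is obtained from a graph with at most six vertices by cloning leaves.
   Context: All graphs are finite and simple. $Y$ is the 7-vertex tree obtained from $K_{1,3}$ by subdividing each edge exactly once. Two chords $v_iv_j$ ($i<j$) and $v_pv_q$ ($p<q$) of $P$ cross if $i<p<j<q$ or $p<i<q<j$. Cloning a vertex $v$ means adding new vertices, pairwise nonadjacent with each other and with $v$, each with the same neighbourhood as $v$; cloning leaves means applying this to degree-1 vertices. -}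

module Defs where

open import Data.Nat using (ℕ; zero; suc; _+_; _∸_; _≤_; _<_)
open import Data.Fin using (Fin)
open import Data.Bool using (Bool; true; false; if_then_else_)
open import Data.List using (List; map; allFin)
open import Data.Nat.ListAction using (sum)
open import Data.Product using (Σ; ∃; _×_; _,_)
open import Data.Sum using (_⊎_)
open import Relation.Nullary using (¬_)
open import Relation.Binary.PropositionalEquality using (_≡_; _≢_)
open import Function.Definitions using (Injective)

record Graph : Set where
  field
    n      : ℕ
    adj    : Fin n → Fin n → Bool
    sym    : ∀ u v → adj u v ≡ adj v u
    irrefl : ∀ v → adj v v ≡ false

open Graph public

Edge : (G : Graph) → Fin (n G) → Fin (n G) → Set
Edge G u v = adj G u v ≡ true

deg : (G : Graph) → Fin (n G) → ℕ
deg G v = sum (map (λ u → if adj G v u then 1 else 0) (allFin (n G)))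

-- p : ℕ → V is a path v_0 v_1 ... v_ℓ (values of p beyond ℓ are irrelevant)
record IsPath (G : Graph) (ℓ : ℕ) (p : ℕ → Fin (n G)) : Set where
  field
    step : ∀ i → i < ℓ → Edge G (p i) (p (suc i))
    inj  : ∀ i j → i ≤ ℓ → j ≤ ℓ → p i ≡ p j → i ≡ j

Connected : Graph → Set
Connected G = ∀ u v → Σ ℕ λ m → Σ (ℕ → Fin (n G)) λ q →
  IsPath G m q × q 0 ≡ u × q m ≡ v

OnPath : (G : Graph) → ℕ → (ℕ → Fin (n G)) → Fin (n G) → Set
OnPath G ℓ p x = Σ ℕ λ i → i ≤ ℓ × p i ≡ x

InL : (G : Graph) → ℕ → (ℕ → Fin (n G)) → ℕ → Fin (n G) → Set
InL G ℓ p i x = Edge G (p i) x × ¬ OnPath G ℓ p x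

-- Y = K_{1,3} with each edge subdivided once: centre 0, middle 1,2,3, leaves 4,5,6
YSubgraph : Graph → Set
YSubgraph G = Σ (Fin 7 → Fin (n G)) λ f → Injective _≡_ _≡_ f ×
  Edge G (f (# 0)) (f (# 1)) × Edge G (f (# 0)) (f (# 2)) × Edge G (f (# 0)) (f (# 3)) ×
  Edge G (f (# 1)) (f (# 4)) × Edge G (f (# 2)) (f (# 5)) × Edge G (f (# 3)) (f (# 6))
  where open import Data.Fin using (#_)

Crosses : ℕ → ℕ → ℕ → ℕ → Set
Crosses i j a b = (i < a × a < j × j < b) ⊎ (a < i × i < b × b < j)

-- G is obtained from H by cloning leaves (every leaf of H cloned simultaneously
-- some number ≥ 0 of times): a surjection φ : V(G) → V(H) with
-- adjacency pulled back from H, and nontrivial fibres only over leaves of H.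
ClonedLeavesOf : Graph → Graph → Set
ClonedLeavesOf G H = Σ (Fin (n G) → Fin (n H)) λ φ →
  (∀ h → Σ (Fin (n G)) λ u → φ u ≡ h) ×
  (∀ u v → adj G u v ≡ adj H (φ u) (φ v)) ×
  (∀ u v → u ≢ v → φ u ≡ φ v → deg H (φ u) ≡ 1)

Fin' : Graph → Set
Fin' G = Fin (n G)

ObtainedBySmallCloning : Graph → Set
ObtainedBySmallCloning G = Σ Graph λ H → n H ≤ 6 × ClonedLeavesOf G H

-- Up to reversing P we may assume that v₀v₃ and v₂v₄ are edges.  If ℓ ≥ 6 they
-- give a Y with centre v₄ and legs v₃v₀, v₅v₆, v₂v₁.  If ℓ = 5, the graph on
-- v₀ … v₅ has a Hamiltonian path starting at each of v₀, v₁, v₂, v₃, v₅, so a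
-- vertex x off P has no neighbour on P other than v₄ (else P is not longest);
-- likewise adjacent x, y off P with y ~ v₄ would give the path x y v₄ v₃ v₀ v₁ v₂.
-- By connectivity every vertex off P is therefore a leaf at v₄.  Once such an x
-- exists, the paths x v₄ v₅ v₂ v₁ v₀ v₃ and x v₄ v₅ v₃ v₀ v₁ v₂ show that v₅ is a
-- leaf at v₄ as well, so the vertices off P are exactly the clones of the leaf v₅
-- of G[v₀ … v₅].
module Submission where

open import Defs
open import Data.Bool using (false; true; if_then_else_)
open import Data.Empty using (⊥; ⊥-elim)
open import Data.Fin using (Fin; toℕ)
open import Data.Fin.Patterns using (0F; 1F; 2F; 3F; 4F; 5F; 6F)
open import Data.Fin.Properties using (toℕ-injective; toℕ≤pred[n]; any?; all?)
  renaming (_≟_ to _≟ᶠ_)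
open import Data.List using (List; []; _∷_; _++_; map; length; allFin)
open import Data.List.Properties using (map-cong)
open import Data.List.Membership.Propositional using (_∈_)
open import Data.List.Membership.Propositional.Properties using (∈-map⁻)
open import Data.List.Relation.Unary.All as All using (All; []; _∷_)
open import Data.List.Relation.Unary.AllPairs using ([]; _∷_)
open import Data.List.Relation.Unary.Any using (here; there)
open import Data.List.Relation.Unary.Linked using (Linked; [-]; _∷_)
open import Data.List.Relation.Unary.Unique.DecPropositional using (unique?)
open import Data.List.Relation.Unary.Unique.Propositional using (Unique)
open import Data.List.Relation.Unary.Unique.Propositional.Properties using (map⁺; ++⁺)
open import Data.Nat using (ℕ; zero; suc; _+_; _∸_; _≤_; _<_; z≤n; s≤s; _<?_)
open import Data.Nat.ListAction using (sum)
open import Data.Nat.Properties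
  using (≤-refl; ≤-antisym; ≤-pred; ≤-trans; ≤⇒≯; +-comm; +-∸-assoc; m+n∸n≡m;
         m∸n≤m; m∸[m∸n]≡n; n≤1+n; m≤n⇒m<n∨m≡n)
open import Data.Product using (Σ; ∃; _×_; _,_; proj₁; proj₂)
open import Data.Sum using (_⊎_; inj₁; inj₂; [_,_])
open import Data.Vec using (lookup; []; _∷_)
open import Function using (_∘_)
open import Function.Definitions using (Injective)
open import Relation.Nullary using (¬_; Dec; yes; no; map′)
open import Relation.Nullary.Decidable using (True; toWitness; from-yes; ⌊_⌋; _→-dec_)
open import Relation.Binary.PropositionalEquality
  using (_≡_; _≢_; refl; cong; trans; subst; subst₂) renaming (sym to ≡-sym)

injective? : ∀ {m k} (f : Fin m → Fin k) → Dec (Injective _≡_ _≡_ f)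
injective? f = map′ (λ inj {i} {j} → inj i j) (λ inj i j → inj)
  (all? λ i → all? λ j → (f i ≟ᶠ f j) →-dec (i ≟ᶠ j))

crosses-start : ∀ i → Crosses i (i + 2) 0 3 → i ≡ 2
crosses-start i (inj₁ (() , _))
crosses-start i (inj₂ (_ , i<3 , 3<i+2)) =
  ≤-antisym (≤-pred i<3) (≤-pred (≤-pred (subst (4 ≤_) (+-comm i 2) 3<i+2)))

crosses-end : ∀ ℓ i → i + 2 ≤ ℓ → Crosses i (i + 2) (ℓ ∸ 3) ℓ → ℓ ≡ i + 4
crosses-end ℓ i i+2≤ℓ (inj₂ (_ , _ , ℓ<i+2)) = ⊥-elim (≤⇒≯ i+2≤ℓ ℓ<i+2)
crosses-end 0 i _ (inj₁ (() , _))
crosses-end 1 i _ (inj₁ (() , _))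
crosses-end 2 i _ (inj₁ (() , _))
crosses-end (suc (suc (suc m))) i _ (inj₁ (i<m , m<i+2 , _)) =
  trans (cong (3 +_) m≡1+i) (+-comm 4 i)
  where
  m≡1+i : m ≡ suc i
  m≡1+i = ≤-antisym (≤-pred (subst (suc m ≤_) (+-comm i 2) m<i+2)) i<m

reversed : ∀ {A : Set} → ℕ → (ℕ → A) → ℕ → A
reversed ℓ p i = p (ℓ ∸ i)

module GraphFacts (G : Graph) where

  Edge-sym : ∀ {u v} → Edge G u v → Edge G v u
  Edge-sym {u} {v} e = trans (Graph.sym G v u) e

  Edge⇒≢ : ∀ {u v} → Edge G u v → u ≢ v
  Edge⇒≢ {u} e refl with trans (≡-sym e) (Graph.irrefl G u)
  ... | ()

  ¬Edge⇒adj≡false : ∀ {u v} → ¬ Edge G u v → adj G u v ≡ false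
  ¬Edge⇒adj≡false {u} {v} ¬e with adj G u v
  ... | false = refl
  ... | true  = ⊥-elim (¬e refl)

  adj≡adj-representatives : (ρ : Fin' G → Fin' G) → (∀ u w → adj G u w ≡ adj G (ρ u) w) →
    ∀ u v → adj G u v ≡ adj G (ρ u) (ρ v)
  adj≡adj-representatives ρ twin u v =
    trans (twin u v) (trans (Graph.sym G (ρ u) v)
      (trans (twin v (ρ u)) (Graph.sym G (ρ v) (ρ u))))

  connected-induction : Connected G → (Good : Fin' G → Set) →
    (∀ {u v} → Edge G u v → Good v → Good u) → ∀ t → Good t → ∀ x → Good x
  connected-induction conn Good closed t good-t x with conn x t
  ... | m , q , Q , refl , refl = along m q (IsPath.step Q) good-t
    where
    along : ∀ m (q : ℕ → Fin' G) → (∀ i → i < m → Edge G (q i) (q (suc i))) → Good (q m) → Good (q 0)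
    along zero q _ good = good
    along (suc m) q step good =
      closed (step 0 (s≤s z≤n)) (along m (q ∘ suc) (λ i i<m → step (suc i) (s≤s i<m)) good)

  IsPath-prefix : ∀ {ℓ m p} → m ≤ ℓ → IsPath G ℓ p → IsPath G m p
  IsPath-prefix m≤ℓ P = record
    { step = λ i i<m → IsPath.step P i (≤-trans i<m m≤ℓ)
    ; inj  = λ i j i≤m j≤m → IsPath.inj P i j (≤-trans i≤m m≤ℓ) (≤-trans j≤m m≤ℓ)
    }

  IsPath-edge : ∀ {ℓ p} → IsPath G ℓ p → ∀ i → {True (i <? ℓ)} → Edge G (p i) (p (suc i))
  IsPath-edge P i {i<ℓ} = IsPath.step P i (toWitness i<ℓ)

  IsPath-reversed : ∀ {ℓ p} → IsPath G ℓ p → IsPath G ℓ (reversed ℓ p)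
  IsPath-reversed {ℓ} {p} P = record { step = step ; inj = inj }
    where
    step : ∀ i → i < ℓ → Edge G (p (ℓ ∸ i)) (p (ℓ ∸ suc i))
    step i i<ℓ = Edge-sym (subst (λ j → Edge G (p (ℓ ∸ suc i)) (p j)) suc[ℓ∸1+i]≡ℓ∸i
      (IsPath.step P (ℓ ∸ suc i) (subst (_≤ ℓ) (≡-sym suc[ℓ∸1+i]≡ℓ∸i) (m∸n≤m ℓ i))))
      where
      suc[ℓ∸1+i]≡ℓ∸i : suc (ℓ ∸ suc i) ≡ ℓ ∸ i
      suc[ℓ∸1+i]≡ℓ∸i = ≡-sym (+-∸-assoc 1 i<ℓ)
    inj : ∀ i j → i ≤ ℓ → j ≤ ℓ → p (ℓ ∸ i) ≡ p (ℓ ∸ j) → i ≡ j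
    inj i j i≤ℓ j≤ℓ eq = trans (≡-sym (m∸[m∸n]≡n i≤ℓ))
      (trans (cong (ℓ ∸_) (IsPath.inj P _ _ (m∸n≤m ℓ i) (m∸n≤m ℓ j) eq)) (m∸[m∸n]≡n j≤ℓ))

  induced : ∀ {m} → (Fin m → Fin' G) → Graph
  induced {m} f = record
    { n      = m
    ; adj    = λ i j → adj G (f i) (f j)
    ; sym    = λ i j → Graph.sym G (f i) (f j)
    ; irrefl = λ i → Graph.irrefl G (f i)
    }

  walk : Fin' G → List (Fin' G) → ℕ → Fin' G
  walk v vs       zero    = v
  walk v []       (suc i) = v
  walk v (w ∷ ws) (suc i) = walk w ws i

  walk-∈ : ∀ v vs i → i ≤ length vs → walk v vs i ∈ v ∷ vs
  walk-∈ v vs       zero    _         = here refl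
  walk-∈ v (w ∷ ws) (suc i) (s≤s i≤) = there (walk-∈ w ws i i≤)

  walk-isPath : ∀ v vs → Linked (Edge G) (v ∷ vs) → Unique (v ∷ vs) → IsPath G (length vs) (walk v vs)
  walk-isPath v vs linked unique = record { step = step v vs linked ; inj = inj v vs unique }
    where
    step : ∀ v vs → Linked (Edge G) (v ∷ vs) → ∀ i → i < length vs → Edge G (walk v vs i) (walk v vs (suc i))
    step v (w ∷ ws) (e ∷ _)      zero    _        = e
    step v (w ∷ ws) (_ ∷ linked) (suc i) (s≤s i<) = step w ws linked i i<
    inj : ∀ v vs → Unique (v ∷ vs) → ∀ i j → i ≤ length vs → j ≤ length vs → walk v vs i ≡ walk v vs j → i ≡ j
    inj v vs       _               zero    zero    _ _ _ = refl
    inj v (w ∷ ws) (v∉ ∷ _)       zero    (suc j) _ (s≤s j≤) eq = ⊥-elim (All.lookup v∉ (walk-∈ w ws j j≤) eq)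
    inj v (w ∷ ws) (v∉ ∷ _)       (suc i) zero    (s≤s i≤) _ eq = ⊥-elim (All.lookup v∉ (walk-∈ w ws i i≤) (≡-sym eq))
    inj v (w ∷ ws) (_ ∷ unique)   (suc i) (suc j) (s≤s i≤) (s≤s j≤) eq = cong suc (inj w ws unique i j i≤ j≤ eq)

  length≤-longest : ∀ {ℓ} → (∀ m q → IsPath G m q → m ≤ ℓ) →
    ∀ vs → Linked (Edge G) vs → Unique vs → length vs ≤ suc ℓ
  length≤-longest longest []       _      _      = z≤n
  length≤-longest longest (v ∷ vs) linked unique = s≤s (longest _ _ (walk-isPath v vs linked unique))

module PathVertices {G : Graph} {ℓ} {p : ℕ → Fin' G} (P : IsPath G ℓ p) where
  open GraphFacts G

  vertex : Fin (suc ℓ) → Fin' G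
  vertex k = p (toℕ k)

  vertex-injective : Injective _≡_ _≡_ vertex
  vertex-injective {k} {j} eq = toℕ-injective (IsPath.inj P _ _ (toℕ≤pred[n] k) (toℕ≤pred[n] j) eq)

  OnP : Fin' G → Set
  OnP x = ∃ λ k → vertex k ≡ x

  onP? : ∀ x → Dec (OnP x)
  onP? x = any? λ k → vertex k ≟ᶠ x

  OffP : Fin' G → Set
  OffP x = ¬ OnP x

  offP++vertices-unique : ∀ {xs ns} → Unique xs → All OffP xs → Unique ns → Unique (xs ++ map vertex ns)
  offP++vertices-unique {xs} {ns} unique-xs off unique-ns = ++⁺ unique-xs (map⁺ vertex-injective unique-ns) disjoint
    where
    disjoint : ∀ {z} → ¬ (z ∈ xs × z ∈ map vertex ns)
    disjoint (z∈xs , z∈vertices) with ∈-map⁻ vertex z∈vertices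
    ... | k , _ , refl = All.lookup off z∈xs (k , refl)

StartCrossing : (G : Graph) → (ℕ → Fin' G) → Set
StartCrossing G p = Edge G (p 0) (p 3) × Edge G (p 2) (p 4)

crossing⇒StartCrossing : ∀ {G ℓ} {p : ℕ → Fin' G} i → i + 2 ≤ ℓ → Edge G (p i) (p (i + 2)) →
  (Edge G (p 0) (p 3) × Crosses i (i + 2) 0 3) ⊎ (Edge G (p (ℓ ∸ 3)) (p ℓ) × Crosses i (i + 2) (ℓ ∸ 3) ℓ) →
  StartCrossing G p ⊎ StartCrossing G (reversed ℓ p)
crossing⇒StartCrossing i _ e (inj₁ (e03 , crossing)) with crosses-start i crossing
... | refl = inj₁ (e03 , e)
crossing⇒StartCrossing {G} {ℓ} {p} i i+2≤ℓ e (inj₂ (eℓ , crossing)) with crosses-end ℓ i i+2≤ℓ crossing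
... | refl = inj₂ (Edge-sym eℓ , subst₂ (λ a b → Edge G (p a) (p b)) i+2≡[i+4]∸2 i≡[i+4]∸4 (Edge-sym e))
  where
  open GraphFacts G
  i+2≡[i+4]∸2 : i + 2 ≡ i + 4 ∸ 2
  i+2≡[i+4]∸2 = ≡-sym (+-∸-assoc i {4} {2} (s≤s (s≤s z≤n)))
  i≡[i+4]∸4 : i ≡ i + 4 ∸ 4
  i≡[i+4]∸4 = ≡-sym (m+n∸n≡m i 4)

startCrossing⇒Y : ∀ {G ℓ} {p : ℕ → Fin' G} → 6 ≤ ℓ → IsPath G ℓ p → StartCrossing G p → YSubgraph G
startCrossing⇒Y {G} {ℓ} {p} 6≤ℓ P (e03 , e24) =
  vertex ∘ legs , (λ eq → legs-injective (vertex-injective eq)) ,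
  Edge-sym (step 3) , step 4 , Edge-sym e24 , Edge-sym e03 , step 5 , Edge-sym (step 1)
  where
  open GraphFacts G
  P₆ : IsPath G 6 p
  P₆ = IsPath-prefix 6≤ℓ P
  open PathVertices P₆
  step : ∀ i → {True (i <? 6)} → Edge G (p i) (p (suc i))
  step = IsPath-edge P₆
  -- centre v₄, middle vertices v₃ v₅ v₂, leaves v₀ v₆ v₁ (in the order YSubgraph expects)
  legs : Fin 7 → Fin 7
  legs = lookup (4F ∷ 3F ∷ 5F ∷ 2F ∷ 0F ∷ 6F ∷ 1F ∷ [])
  legs-injective : Injective _≡_ _≡_ legs
  legs-injective = from-yes (injective? legs)

module CrossedFivePath {G : Graph} (conn : Connected G) (longest : ∀ m q → IsPath G m q → m ≤ 5)
  {p : ℕ → Fin' G} (P : IsPath G 5 p) (crossing : StartCrossing G p)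
  (¬e05 : ¬ Edge G (p 0) (p 5)) (¬e15 : ¬ Edge G (p 1) (p 5)) where

  open GraphFacts G
  open PathVertices P

  e01 : Edge G (p 0) (p 1)
  e01 = IsPath-edge P 0
  e12 : Edge G (p 1) (p 2)
  e12 = IsPath-edge P 1
  e23 : Edge G (p 2) (p 3)
  e23 = IsPath-edge P 2
  e34 : Edge G (p 3) (p 4)
  e34 = IsPath-edge P 3
  e45 : Edge G (p 4) (p 5)
  e45 = IsPath-edge P 4
  e03 : Edge G (p 0) (p 3)
  e03 = proj₁ crossing
  e24 : Edge G (p 2) (p 4)
  e24 = proj₂ crossing

  noSevenVertexPath : ∀ {xs} ns → Unique xs → All OffP xs → {True (unique? _≟ᶠ_ ns)} →
    Linked (Edge G) (xs ++ map vertex ns) → {True (6 <? length (xs ++ map vertex ns))} → ⊥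
  noSevenVertexPath ns unique-xs off {unique-ns} linked {long} =
    ≤⇒≯ (length≤-longest longest _ linked (offP++vertices-unique unique-xs off (toWitness unique-ns))) (toWitness long)

  offP-neighbour : ∀ {x} → OffP x → ∀ k → Edge G x (vertex k) → k ≡ 4F
  offP-neighbour ox 0F e = ⊥-elim (noSevenVertexPath (0F ∷ 1F ∷ 2F ∷ 3F ∷ 4F ∷ 5F ∷ []) ([] ∷ []) (ox ∷ [])
    (e ∷ e01 ∷ e12 ∷ e23 ∷ e34 ∷ e45 ∷ [-]))
  offP-neighbour ox 1F e = ⊥-elim (noSevenVertexPath (1F ∷ 0F ∷ 3F ∷ 2F ∷ 4F ∷ 5F ∷ []) ([] ∷ []) (ox ∷ [])
    (e ∷ Edge-sym e01 ∷ e03 ∷ Edge-sym e23 ∷ e24 ∷ e45 ∷ [-]))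
  offP-neighbour ox 2F e = ⊥-elim (noSevenVertexPath (2F ∷ 1F ∷ 0F ∷ 3F ∷ 4F ∷ 5F ∷ []) ([] ∷ []) (ox ∷ [])
    (e ∷ Edge-sym e12 ∷ Edge-sym e01 ∷ e03 ∷ e34 ∷ e45 ∷ [-]))
  offP-neighbour ox 3F e = ⊥-elim (noSevenVertexPath (3F ∷ 0F ∷ 1F ∷ 2F ∷ 4F ∷ 5F ∷ []) ([] ∷ []) (ox ∷ [])
    (e ∷ Edge-sym e03 ∷ e01 ∷ e12 ∷ e24 ∷ e45 ∷ [-]))
  offP-neighbour ox 4F e = refl
  offP-neighbour ox 5F e = ⊥-elim (noSevenVertexPath (5F ∷ 4F ∷ 3F ∷ 2F ∷ 1F ∷ 0F ∷ []) ([] ∷ []) (ox ∷ [])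
    (e ∷ Edge-sym e45 ∷ Edge-sym e34 ∷ Edge-sym e23 ∷ Edge-sym e12 ∷ Edge-sym e01 ∷ [-]))

  offP-¬adj-attached : ∀ {x y} → OffP x → OffP y → Edge G y (p 4) → ¬ Edge G x y
  offP-¬adj-attached ox oy e4 e = noSevenVertexPath (4F ∷ 3F ∷ 0F ∷ 1F ∷ 2F ∷ []) ((Edge⇒≢ e ∷ []) ∷ [] ∷ []) (ox ∷ oy ∷ [])
    (e ∷ e4 ∷ Edge-sym e34 ∷ Edge-sym e03 ∷ e01 ∷ e12 ∷ [-])

  last-neighbour : ∀ {x} → OffP x → Edge G x (p 4) → ∀ k → Edge G (p 5) (vertex k) → k ≡ 4F
  last-neighbour ox e4 0F e = ⊥-elim (¬e05 (Edge-sym e))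
  last-neighbour ox e4 1F e = ⊥-elim (¬e15 (Edge-sym e))
  last-neighbour ox e4 2F e = ⊥-elim (noSevenVertexPath (4F ∷ 5F ∷ 2F ∷ 1F ∷ 0F ∷ 3F ∷ []) ([] ∷ []) (ox ∷ [])
    (e4 ∷ e45 ∷ e ∷ Edge-sym e12 ∷ Edge-sym e01 ∷ e03 ∷ [-]))
  last-neighbour ox e4 3F e = ⊥-elim (noSevenVertexPath (4F ∷ 5F ∷ 3F ∷ 0F ∷ 1F ∷ 2F ∷ []) ([] ∷ []) (ox ∷ [])
    (e4 ∷ e45 ∷ e ∷ Edge-sym e03 ∷ e01 ∷ e12 ∷ [-]))
  last-neighbour ox e4 4F e = refl
  last-neighbour ox e4 5F e = ⊥-elim (Edge⇒≢ e refl)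

  offP⇒attached : ∀ {x} → OffP x → Edge G x (p 4)
  offP⇒attached {x} ox = [ ⊥-elim ∘ ox , proj₂ ] (connected-induction conn Good closed (p 0) (inj₁ (0F , refl)) x)
    where
    Good : Fin' G → Set
    Good u = OnP u ⊎ (OffP u × Edge G u (p 4))
    closed : ∀ {u v} → Edge G u v → Good v → Good u
    closed {u} e good with onP? u | good
    ... | yes onP | _                 = inj₁ onP
    ... | no ou   | inj₁ (k , refl)   = inj₂ (ou , subst (λ k → Edge G u (vertex k)) (offP-neighbour ou k e) e)
    ... | no ou   | inj₂ (ov , e4)    = ⊥-elim (offP-¬adj-attached ou ov e4 e)

  offP-independent : ∀ {x y} → OffP x → OffP y → ¬ Edge G x y
  offP-independent ox oy = offP-¬adj-attached ox oy (offP⇒attached oy)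

  AttachedAt4 : Fin' G → Set
  AttachedAt4 u = ∀ k → adj G u (vertex k) ≡ ⌊ k ≟ᶠ 4F ⌋

  attachedAt4 : ∀ {u} → Edge G u (p 4) → (∀ k → Edge G u (vertex k) → k ≡ 4F) → AttachedAt4 u
  attachedAt4 e4 only k with k ≟ᶠ 4F
  ... | yes refl = e4
  ... | no k≢4   = ¬Edge⇒adj≡false (k≢4 ∘ only k)

  offP-attachedAt4 : ∀ {x} → OffP x → AttachedAt4 x
  offP-attachedAt4 ox = attachedAt4 (offP⇒attached ox) (offP-neighbour ox)

  last-attachedAt4 : ∀ {x} → OffP x → AttachedAt4 (p 5)
  last-attachedAt4 ox = attachedAt4 (Edge-sym e45) (last-neighbour ox (offP⇒attached ox))

  offP-twin-of-last : ∀ {x} → OffP x → ∀ w → adj G x w ≡ adj G (p 5) w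
  offP-twin-of-last ox w with onP? w
  ... | yes (k , refl) = trans (offP-attachedAt4 ox k) (≡-sym (last-attachedAt4 ox k))
  ... | no ow = trans (¬Edge⇒adj≡false (offP-independent ox ow))
                  (≡-sym (¬Edge⇒adj≡false (λ e → 5≢4 (offP-neighbour ow 5F (Edge-sym e)))))
    where
    5≢4 : 5F ≢ 4F
    5≢4 ()

  H : Graph
  H = induced vertex

  representative : Fin' G → Fin 6
  representative v with onP? v
  ... | yes (k , _) = k
  ... | no _        = 5F

  representative-vertex : ∀ k → representative (vertex k) ≡ k
  representative-vertex k with onP? (vertex k)
  ... | yes (j , eq) = vertex-injective eq
  ... | no off       = ⊥-elim (off (k , refl))

  twin-of-representative : ∀ u w → adj G u w ≡ adj G (vertex (representative u)) w
  twin-of-representative u w with onP? u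
  ... | yes (k , refl) = refl
  ... | no ou          = offP-twin-of-last ou w

  deg-last : ∀ {x} → OffP x → deg H 5F ≡ 1
  deg-last ox = cong sum (map-cong (λ k → cong (λ b → if b then 1 else 0) (last-attachedAt4 ox k)) (allFin 6))

  fibre-degree : ∀ u v → u ≢ v → representative u ≡ representative v → deg H (representative u) ≡ 1
  fibre-degree u v u≢v eq with onP? u | onP? v
  ... | yes (k , refl) | yes (j , refl) = ⊥-elim (u≢v (cong vertex eq))
  ... | no ou          | _              = deg-last ou
  ... | yes (k , refl) | no ov          = subst (λ k → deg H k ≡ 1) (≡-sym eq) (deg-last ov)

  obtainedBySmallCloning : ObtainedBySmallCloning G
  obtainedBySmallCloning =
    H , ≤-refl , representative , (λ k → vertex k , representative-vertex k) ,
    adj≡adj-representatives (vertex ∘ representative) twin-of-representative , fibre-degree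

lemma3p3 : (G : Graph) → Connected G → ¬ YSubgraph G →
    (ℓ : ℕ) (p : ℕ → Fin' G) → IsPath G ℓ p →
    (∀ m q → IsPath G m q → m ≤ ℓ) →
    (∀ q → IsPath G ℓ q → deg G (p 0) + deg G (p ℓ) ≤ deg G (q 0) + deg G (q ℓ)) →
    5 ≤ ℓ →
    (∀ a b → a ≤ 1 → ℓ ∸ 1 ≤ b → b ≤ ℓ → ¬ Edge G (p a) (p b)) →
    (∀ x → ¬ (InL G ℓ p 1 x × InL G ℓ p (ℓ ∸ 1) x)) →
    (Σ ℕ λ i → i + 2 ≤ ℓ × Edge G (p i) (p (i + 2)) ×
      ((Edge G (p 0) (p 3) × Crosses i (i + 2) 0 3) ⊎
       (Edge G (p (ℓ ∸ 3)) (p ℓ) × Crosses i (i + 2) (ℓ ∸ 3) ℓ))) →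
    ℓ ≡ 5 × ObtainedBySmallCloning G
lemma3p3 G conn noY ℓ p P longest _ 5≤ℓ ends-apart _ (i , i+2≤ℓ , e , crossing)
  with crossing⇒StartCrossing {G} {ℓ} {p} i i+2≤ℓ e crossing | m≤n⇒m<n∨m≡n 5≤ℓ
... | start | inj₁ 6≤ℓ =
  ⊥-elim (noY ([ startCrossing⇒Y 6≤ℓ P , startCrossing⇒Y {p = reversed ℓ p} 6≤ℓ (IsPath-reversed P) ] start))
  where open GraphFacts G
... | inj₁ start | inj₂ refl =
  refl , CrossedFivePath.obtainedBySmallCloning conn longest P start ¬e05 ¬e15
  where
  ¬e05 : ¬ Edge G (p 0) (p 5)
  ¬e05 = ends-apart 0 5 z≤n (n≤1+n 4) ≤-refl
  ¬e15 : ¬ Edge G (p 1) (p 5)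
  ¬e15 = ends-apart 1 5 ≤-refl (n≤1+n 4) ≤-refl
... | inj₂ start | inj₂ refl =
  refl , CrossedFivePath.obtainedBySmallCloning conn longest (IsPath-reversed P) start ¬e50 ¬e40
  where
  open GraphFacts G
  ¬e50 : ¬ Edge G (p 5) (p 0)
  ¬e50 = ends-apart 0 5 z≤n (n≤1+n 4) ≤-refl ∘ Edge-sym
  ¬e40 : ¬ Edge G (p 4) (p 0)
  ¬e40 = ends-apart 0 4 z≤n ≤-refl (n≤1+n 4) ∘ Edge-sym
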